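{- Let $\alpha:\mathbb{A}^\Delta\to(H,V)$ be a morphism into a finite forest algebra, let $\beta$ be its leaf completion, and let $h\in H$ be such that $\beta^{ -1}(h)$ is definable in $\mathrm{FO}^2(<_v,<_h)$. Then $\alpha^{ -1}(h)$ is definable in $\mathrm{FO}^2(<_v,<_h)$.
   Context: $\mathbb{A}=(A,B)$ is a finite alphabet ($A$ leaf labels, $B$ inner labels); forests are finite, ordered, unranked, nonempty: each $a\in A$ is a tree, $b(s)$ is a tree for $b\in B$ and a forest $s$, and a forest is a nonempty sequence $t_1+\dots+t_k$ of trees. A context is a forest over $(A\cup\{\square\},B)$ with exactly one leaf labelled $\square$, not a root and without siblings. A forest algebra is a pair $(H,V)$ of finite semigroups ($H$ additive, $V$ multiplicative) with a left action $V\times H\to H$ satisfying $w(vh)=(wv)h$ and such that for all $g\in H,v\in V$ there are $v+g,g+v\in V$ with $(v+g)h=vh+g$, $(g+v)h=g+vh$. The free forest algebra $\mathbb{A}^\Delta$ consists of forests (under $+$) and contexts (under composition by substitution at the port); a morphism is a pair of semigroup morphisms compatible with the action. The leaf completion of $\alpha:(A,B)^\Delta\to(H,V)$ is the morphism $\beta:(A\cup H,B)^\Delta\to(H,V)$ that extends $\alpha$ and maps each new leaf label $h\in H$ to $h$. $\mathrm{FO}^2(<_v,<_h)$ is two-variable first-order logic on forests with unary label predicates, $x<_v y$ ($x$ strict ancestor of $y$) and $x<_h y$ ($y$ strict following sibling of $x$). -}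

module Defs where

open import Data.Nat using (ℕ)
open import Data.Fin using (Fin)
open import Data.Bool using (Bool; true; false; _∨_)
open import Data.List using (List; []; _∷_)
open import Data.Sum using (_⊎_; inj₁; inj₂)
open import Data.Product using (Σ; _×_; _,_)
open import Relation.Nullary using (¬_)
open import Relation.Binary.PropositionalEquality using (_≡_)
open import Function.Bundles using (_↔_)

Finite : Set → Set
Finite X = Σ ℕ (λ n → X ↔ Fin n)

data Tree (A B : Set) : Set
data Forest (A B : Set) : Set

data Tree A B where
  leaf : A → Tree A B
  node : B → Forest A B → Tree A B

data Forest A B where
  [_] : Tree A B → Forest A B
  _∷_ : Tree A B → Forest A B → Forest A B

infixr 5 _∷_ _++_

_++_ : ∀ {A B} → Forest A B → Forest A B → Forest A B
[ t ] ++ s = t ∷ s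
(t ∷ f) ++ s = t ∷ (f ++ s)

prepend : ∀ {A B} → List (Tree A B) → Forest A B → Forest A B
prepend [] f = f
prepend (t ∷ ts) f = t ∷ prepend ts f

fromList⁺ : ∀ {A B} → Tree A B → List (Tree A B) → Forest A B
fromList⁺ t [] = [ t ]
fromList⁺ t (u ∷ us) = t ∷ fromList⁺ u us

-- Contexts: forests over (A ∪ {□}, B) with exactly one □-leaf, which is
-- not a root and has no siblings, i.e. it occurs as b(□).
-- A context is  l₁+…+lₘ + T + r₁+…+rₙ  where T is the tree containing □.

data CTree (A B : Set) : Set
data Context (A B : Set) : Set

data CTree A B where
  hole  : B → CTree A B
  cnode : B → Context A B → CTree A B

data Context A B where
  ctx : List (Tree A B) → CTree A B → List (Tree A B) → Context A B

plugT : ∀ {A B} → CTree A B → Forest A B → Tree A B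
plug  : ∀ {A B} → Context A B → Forest A B → Forest A B
plugT (hole b) s = node b s
plugT (cnode b c) s = node b (plug c s)
plug (ctx l t r) s = prepend l (fromList⁺ (plugT t s) r)

composeT : ∀ {A B} → CTree A B → Context A B → CTree A B
compose  : ∀ {A B} → Context A B → Context A B → Context A B
composeT (hole b) d = cnode b d
composeT (cnode b c) d = cnode b (compose c d)
compose (ctx l t r) d = ctx l (composeT t d) r

mapT  : ∀ {A A' B} → (A → A') → Tree A B → Tree A' B
mapF  : ∀ {A A' B} → (A → A') → Forest A B → Forest A' B
mapT f (leaf a) = leaf (f a)
mapT f (node b s) = node b (mapF f s)
mapF f [ t ] = [ mapT f t ]
mapF f (t ∷ s) = mapT f t ∷ mapF f s

mapL : ∀ {A A' B} → (A → A') → List (Tree A B) → List (Tree A' B)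
mapL f [] = []
mapL f (t ∷ ts) = mapT f t ∷ mapL f ts

mapCT : ∀ {A A' B} → (A → A') → CTree A B → CTree A' B
mapC  : ∀ {A A' B} → (A → A') → Context A B → Context A' B
mapCT f (hole b) = hole b
mapCT f (cnode b c) = cnode b (mapC f c)
mapC f (ctx l t r) = ctx (mapL f l) (mapCT f t) (mapL f r)

-- Forest algebras (H,V): H additive semigroup, V multiplicative
-- semigroup, left action V × H → H with w(vh) = (wv)h, and for all
-- g ∈ H, v ∈ V elements v+g, g+v ∈ V with (v+g)h = vh+g, (g+v)h = g+vh.

record ForestAlgebra : Set₁ where
  field
    H : Set
    V : Set
    _⊕_ : H → H → H
    _⊙_ : V → V → V
    act : V → H → H
    ⊕-assoc : ∀ g h k → (g ⊕ h) ⊕ k ≡ g ⊕ (h ⊕ k)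
    ⊙-assoc : ∀ u v w → (u ⊙ v) ⊙ w ≡ u ⊙ (v ⊙ w)
    act-comp : ∀ w v h → act w (act v h) ≡ act (w ⊙ v) h
    right-ins : ∀ (g : H) (v : V) → Σ V (λ u → ∀ h → act u h ≡ (act v h) ⊕ g)
    left-ins  : ∀ (g : H) (v : V) → Σ V (λ u → ∀ h → act u h ≡ g ⊕ (act v h))

-- Morphisms from the free forest algebra (A,B)^Δ into (H,V)
record Morphism (A B : Set) (F : ForestAlgebra) : Set where
  open ForestAlgebra F
  field
    fH : Forest A B → H
    fV : Context A B → V
    pres-+   : ∀ s t → fH (s ++ t) ≡ fH s ⊕ fH t
    pres-·   : ∀ c d → fV (compose c d) ≡ fV c ⊙ fV d
    pres-act : ∀ c s → fH (plug c s) ≡ act (fV c) (fH s)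

record IsLeafCompletion {A B : Set} {F : ForestAlgebra}
         (α : Morphism A B F)
         (β : Morphism (A ⊎ ForestAlgebra.H F) B F) : Set where
  field
    ext-H : ∀ s → Morphism.fH β (mapF inj₁ s) ≡ Morphism.fH α s
    ext-V : ∀ c → Morphism.fV β (mapC inj₁ c) ≡ Morphism.fV α c
    new-leaf : ∀ h → Morphism.fH β [ leaf (inj₂ h) ] ≡ h

module _ {A B : Set} where

  data TPos : Tree A B → Set
  data FPos : Forest A B → Set

  data TPos where
    root  : ∀ {t} → TPos t
    child : ∀ {b s} → FPos s → TPos (node b s)

  data FPos where
    only : ∀ {t} → TPos t → FPos [ t ]
    head : ∀ {t f} → TPos t → FPos (t ∷ f)
    tail : ∀ {t f} → FPos f → FPos (t ∷ f)

  tlabel : ∀ {t} → TPos t → A ⊎ B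
  flabel : ∀ {f} → FPos f → A ⊎ B
  tlabel {leaf a} root = inj₁ a
  tlabel {node b s} root = inj₂ b
  tlabel (child p) = flabel p
  flabel (only p) = tlabel p
  flabel (head p) = tlabel p
  flabel (tail p) = flabel p

  data TAnc : ∀ {t} → TPos t → TPos t → Set
  data FAnc : ∀ {f} → FPos f → FPos f → Set

  data TAnc where
    root-anc  : ∀ {b s} {p : FPos s} → TAnc {node b s} root (child p)
    child-anc : ∀ {b s} {p q : FPos s} → FAnc p q → TAnc {node b s} (child p) (child q)

  data FAnc where
    only-anc : ∀ {t} {p q : TPos t} → TAnc p q → FAnc {[ t ]} (only p) (only q)
    head-anc : ∀ {t f} {p q : TPos t} → TAnc p q → FAnc {t ∷ f} (head p) (head q)
    tail-anc : ∀ {t f} {p q : FPos f} → FAnc p q → FAnc {t ∷ f} (tail p) (tail q)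

  data FRoot : ∀ {f} → FPos f → Set where
    root-only : ∀ {t} → FRoot {[ t ]} (only root)
    root-head : ∀ {t f} → FRoot {t ∷ f} (head root)
    root-tail : ∀ {t f} {p : FPos f} → FRoot p → FRoot {t ∷ f} (tail p)

  -- strictly following sibling: TSib p q / FSib p q means q is a strict
  -- following sibling of p (roots of a forest are siblings)
  data TSib : ∀ {t} → TPos t → TPos t → Set
  data FSib : ∀ {f} → FPos f → FPos f → Set

  data TSib where
    child-sib : ∀ {b s} {p q : FPos s} → FSib p q → TSib {node b s} (child p) (child q)

  data FSib where
    roots-sib : ∀ {t f} {q : FPos f} → FRoot q → FSib {t ∷ f} (head root) (tail q)
    only-sib  : ∀ {t} {p q : TPos t} → TSib p q → FSib {[ t ]} (only p) (only q)
    head-sib  : ∀ {t f} {p q : TPos t} → TSib p q → FSib {t ∷ f} (head p) (head q)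
    tail-sib  : ∀ {t f} {p q : FPos f} → FSib p q → FSib {t ∷ f} (tail p) (tail q)

  firstPos : (f : Forest A B) → FPos f
  firstPos [ t ] = only root
  firstPos (t ∷ f) = head root

data Var : Set where
  vx vy : Var

data FO2 (L : Set) : Set where
  lab   : L → Var → FO2 L
  _≐_   : Var → Var → FO2 L
  _<v_  : Var → Var → FO2 L
  _<h_  : Var → Var → FO2 L
  ¬'_   : FO2 L → FO2 L
  _∧'_  : FO2 L → FO2 L → FO2 L
  ∃'    : Var → FO2 L → FO2 L

_==_ : Var → Var → Bool
vx == vx = true
vy == vy = true
_ == _ = false

free : ∀ {L} → Var → FO2 L → Bool
free v (lab a w) = v == w
free v (w ≐ u) = (v == w) ∨ (v == u)
free v (w <v u) = (v == w) ∨ (v == u)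
free v (w <h u) = (v == w) ∨ (v == u)
free v (¬' φ) = free v φ
free v (φ ∧' ψ) = free v φ ∨ free v ψ
free v (∃' vx φ) with v
... | vx = false
... | vy = free vy φ
free v (∃' vy φ) with v
... | vx = free vx φ
... | vy = false

IsSentence : ∀ {L} → FO2 L → Set
IsSentence φ = ∀ v → free v φ ≡ false

module _ {A B : Set} where

  Assign : Forest A B → Set
  Assign f = Var → FPos f

  update : ∀ {f} → Assign f → Var → FPos f → Assign f
  update ρ vx p vx = p
  update ρ vx p vy = ρ vy
  update ρ vy p vx = ρ vx
  update ρ vy p vy = p

  Sat : (f : Forest A B) → Assign f → FO2 (A ⊎ B) → Set
  Sat f ρ (lab a v) = flabel (ρ v) ≡ a
  Sat f ρ (v ≐ w) = ρ v ≡ ρ w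
  Sat f ρ (v <v w) = FAnc (ρ v) (ρ w)
  Sat f ρ (v <h w) = FSib (ρ v) (ρ w)
  Sat f ρ (¬' φ) = ¬ Sat f ρ φ
  Sat f ρ (φ ∧' ψ) = Sat f ρ φ × Sat f ρ ψ
  Sat f ρ (∃' v φ) = Σ (FPos f) (λ p → Sat f (update ρ v p) φ)

  -- truth of a sentence in a (nonempty) forest; the assignment is
  -- irrelevant for sentences, we use the constant one at the first root
  _⊨_ : Forest A B → FO2 (A ⊎ B) → Set
  f ⊨ φ = Sat f (λ _ → firstPos f) φ

  Definable : (Forest A B → Set) → Set
  Definable L = Σ (FO2 (A ⊎ B)) (λ φ → IsSentence φ ×
                  (∀ f → (L f → f ⊨ φ) × (f ⊨ φ → L f)))

module Submission where

-- A forest s over (A,B) is also a forest over (A ∪ H, B) (relabel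
-- its leaves along inj₁), and β agrees with α on such forests.  So
-- α⁻¹(h) is the set of s whose relabelling lies in β⁻¹(h).  Relabelling
-- does not change the shape of a forest, hence a sentence φ over the
-- large alphabet can be "pulled back": keep every atom except the label
-- tests for new letters h ∈ H, which no relabelled forest satisfies and
-- which are replaced by a false atom.  The pulled-back sentence holds in
-- s iff φ holds in the relabelling of s.

open import Defs
open import Data.Bool using (_∨_)
open import Data.Bool.Properties using (∨-idem)
open import Data.Maybe using (Maybe; just; nothing)
open import Data.Maybe.Properties using (just-injective)
open import Data.Product using (_,_; proj₁; proj₂)
open import Data.Sum using (_⊎_; inj₁; inj₂)
import Data.Sum as Sum
open import Function using (id; _∘_)
open import Function.Bundles using (_⇔_; mk⇔; Equivalence)
open import Relation.Nullary using (¬_; contradiction)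
open import Relation.Binary.PropositionalEquality
  using (_≡_; refl; sym; trans; cong; cong₂)

open Equivalence using (to; from)

module Relabel {A A' B : Set} (f : A → A') where

  posT : {t : Tree A B} → TPos t → TPos (mapT f t)
  posF : {s : Forest A B} → FPos s → FPos (mapF f s)
  posT root = root
  posT (child p) = child (posF p)
  posF (only p) = only (posT p)
  posF (head p) = head (posT p)
  posF (tail p) = tail (posF p)

  unposT : (t : Tree A B) → TPos (mapT f t) → TPos t
  unposF : (s : Forest A B) → FPos (mapF f s) → FPos s
  unposT (leaf a) root = root
  unposT (node b s) root = root
  unposT (node b s) (child p) = child (unposF s p)
  unposF [ t ] (only p) = only (unposT t p)
  unposF (t ∷ s) (head p) = head (unposT t p)
  unposF (t ∷ s) (tail p) = tail (unposF s p)

  unposT-posT : {t : Tree A B} (p : TPos t) → unposT t (posT p) ≡ p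
  unposF-posF : {s : Forest A B} (p : FPos s) → unposF s (posF p) ≡ p
  unposT-posT {leaf a} root = refl
  unposT-posT {node b s} root = refl
  unposT-posT (child p) = cong child (unposF-posF p)
  unposF-posF (only p) = cong only (unposT-posT p)
  unposF-posF (head p) = cong head (unposT-posT p)
  unposF-posF (tail p) = cong tail (unposF-posF p)

  posT-unposT : (t : Tree A B) (p : TPos (mapT f t)) → posT (unposT t p) ≡ p
  posF-unposF : (s : Forest A B) (p : FPos (mapF f s)) → posF (unposF s p) ≡ p
  posT-unposT (leaf a) root = refl
  posT-unposT (node b s) root = refl
  posT-unposT (node b s) (child p) = cong child (posF-unposF s p)
  posF-unposF [ t ] (only p) = cong only (posT-unposT t p)
  posF-unposF (t ∷ s) (head p) = cong head (posT-unposT t p)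
  posF-unposF (t ∷ s) (tail p) = cong tail (posF-unposF s p)

  posF-injective : {s : Forest A B} {p q : FPos s} → posF p ≡ posF q → p ≡ q
  posF-injective {s} {p} {q} e =
    trans (sym (unposF-posF p)) (trans (cong (unposF s) e) (unposF-posF q))

  label-posT : {t : Tree A B} (p : TPos t) → tlabel (posT p) ≡ Sum.map f id (tlabel p)
  label-posF : {s : Forest A B} (p : FPos s) → flabel (posF p) ≡ Sum.map f id (flabel p)
  label-posT {leaf a} root = refl
  label-posT {node b s} root = refl
  label-posT (child p) = label-posF p
  label-posF (only p) = label-posT p
  label-posF (head p) = label-posT p
  label-posF (tail p) = label-posF p

  first-posF : (s : Forest A B) → firstPos (mapF f s) ≡ posF (firstPos s)
  first-posF [ t ] = refl
  first-posF (t ∷ s) = refl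

  anc-posT : {t : Tree A B} {p q : TPos t} → TAnc p q → TAnc (posT p) (posT q)
  anc-posF : {s : Forest A B} {p q : FPos s} → FAnc p q → FAnc (posF p) (posF q)
  anc-posT root-anc = root-anc
  anc-posT (child-anc a) = child-anc (anc-posF a)
  anc-posF (only-anc a) = only-anc (anc-posT a)
  anc-posF (head-anc a) = head-anc (anc-posT a)
  anc-posF (tail-anc a) = tail-anc (anc-posF a)

  anc-reflectT : {t : Tree A B} (p q : TPos t) → TAnc (posT p) (posT q) → TAnc p q
  anc-reflectF : {s : Forest A B} (p q : FPos s) → FAnc (posF p) (posF q) → FAnc p q
  anc-reflectT root (child q) root-anc = root-anc
  anc-reflectT (child p) (child q) (child-anc a) = child-anc (anc-reflectF p q a)
  anc-reflectF (only p) (only q) (only-anc a) = only-anc (anc-reflectT p q a)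
  anc-reflectF (head p) (head q) (head-anc a) = head-anc (anc-reflectT p q a)
  anc-reflectF (tail p) (tail q) (tail-anc a) = tail-anc (anc-reflectF p q a)

  -- roots are preserved and reflected (needed for siblings at top level)
  root-posF : {s : Forest A B} {p : FPos s} → FRoot p → FRoot (posF p)
  root-posF root-only = root-only
  root-posF root-head = root-head
  root-posF (root-tail r) = root-tail (root-posF r)

  root-reflectF : {s : Forest A B} (p : FPos s) → FRoot (posF p) → FRoot p
  root-reflectF (only root) root-only = root-only
  root-reflectF (head root) root-head = root-head
  root-reflectF (tail p) (root-tail r) = root-tail (root-reflectF p r)

  sib-posT : {t : Tree A B} {p q : TPos t} → TSib p q → TSib (posT p) (posT q)
  sib-posF : {s : Forest A B} {p q : FPos s} → FSib p q → FSib (posF p) (posF q)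
  sib-posT (child-sib a) = child-sib (sib-posF a)
  sib-posF (roots-sib r) = roots-sib (root-posF r)
  sib-posF (only-sib a) = only-sib (sib-posT a)
  sib-posF (head-sib a) = head-sib (sib-posT a)
  sib-posF (tail-sib a) = tail-sib (sib-posF a)

  sib-reflectT : {t : Tree A B} (p q : TPos t) → TSib (posT p) (posT q) → TSib p q
  sib-reflectF : {s : Forest A B} (p q : FPos s) → FSib (posF p) (posF q) → FSib p q
  sib-reflectT (child p) (child q) (child-sib a) = child-sib (sib-reflectF p q a)
  sib-reflectF (only p) (only q) (only-sib a) = only-sib (sib-reflectT p q a)
  sib-reflectF (head p) (head q) (head-sib a) = head-sib (sib-reflectT p q a)
  sib-reflectF (head root) (tail q) (roots-sib r) = roots-sib (root-reflectF q r)
  sib-reflectF (tail p) (tail q) (tail-sib a) = tail-sib (sib-reflectF p q a)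

-- Pulling FO² formulas back along a relabelling f : A → A' that has a
-- decidable partial inverse `back` (so f is injective with decidable image).
module Pullback {A A' B : Set} (f : A → A') (back : A' → Maybe A)
    (back-f : ∀ a → back (f a) ≡ just a)
    (back-just : ∀ {a' a} → back a' ≡ just a → f a ≡ a') where

  open Relabel {A} {A'} {B} f

  -- an atom false at every position, with v as its only free variable
  falsum : Var → FO2 (A ⊎ B)
  falsum v = ¬' (v ≐ v)

  pullLeaf : Maybe A → Var → FO2 (A ⊎ B)
  pullLeaf (just a) v = lab (inj₁ a) v
  pullLeaf nothing v = falsum v

  pull : FO2 (A' ⊎ B) → FO2 (A ⊎ B)
  pull (lab (inj₁ a') v) = pullLeaf (back a') v
  pull (lab (inj₂ b) v) = lab (inj₂ b) v
  pull (v ≐ w) = v ≐ w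
  pull (v <v w) = v <v w
  pull (v <h w) = v <h w
  pull (¬' φ) = ¬' pull φ
  pull (φ ∧' ψ) = pull φ ∧' pull ψ
  pull (∃' v φ) = ∃' v (pull φ)

  free-pullLeaf : ∀ u m v → free u (pullLeaf m v) ≡ (u == v)
  free-pullLeaf u (just a) v = refl
  free-pullLeaf u nothing v = ∨-idem (u == v)

  free-pull : ∀ u φ → free u (pull φ) ≡ free u φ
  free-pull u (lab (inj₁ a') v) = free-pullLeaf u (back a') v
  free-pull u (lab (inj₂ b) v) = refl
  free-pull u (v ≐ w) = refl
  free-pull u (v <v w) = refl
  free-pull u (v <h w) = refl
  free-pull u (¬' φ) = free-pull u φ
  free-pull u (φ ∧' ψ) = cong₂ _∨_ (free-pull u φ) (free-pull u ψ)
  free-pull vx (∃' vx φ) = refl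
  free-pull vy (∃' vx φ) = free-pull vy φ
  free-pull vx (∃' vy φ) = free-pull vx φ
  free-pull vy (∃' vy φ) = refl

  pull-sentence : ∀ φ → IsSentence φ → IsSentence (pull φ)
  pull-sentence φ sent u = trans (free-pull u φ) (sent u)

  inner-label : (x : A ⊎ B) (b : B) → (x ≡ inj₂ b) ⇔ (Sum.map f id x ≡ inj₂ b)
  inner-label x b = mk⇔ (cong (Sum.map f id)) (reflect x)
    where
    reflect : (x : A ⊎ B) → Sum.map f id x ≡ inj₂ b → x ≡ inj₂ b
    reflect (inj₂ b) refl = refl

  leaf-label : (x : A ⊎ B) {a : A} {a' : A'} → back a' ≡ just a →
    (x ≡ inj₁ a) ⇔ (Sum.map f id x ≡ inj₁ a')
  leaf-label x {a} eq = mk⇔ (λ { refl → cong inj₁ (back-just eq) }) (reflect x eq)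
    where
    reflect : (x : A ⊎ B) {a' : A'} → back a' ≡ just a → Sum.map f id x ≡ inj₁ a' → x ≡ inj₁ a
    reflect (inj₁ y) eq refl = cong inj₁ (just-injective (trans (sym (back-f y)) eq))

  absent-label : (x : A ⊎ B) {a' : A'} → back a' ≡ nothing → ¬ (Sum.map f id x ≡ inj₁ a')
  absent-label (inj₁ y) eq refl with trans (sym (back-f y)) eq
  ... | ()

  sat-pull-lab : ∀ {s : Forest A B} (ρ : Assign s) ℓ v →
    Sat s ρ (pull (lab ℓ v)) ⇔ (Sum.map f id (flabel (ρ v)) ≡ ℓ)
  sat-pull-lab ρ (inj₂ b) v = inner-label (flabel (ρ v)) b
  sat-pull-lab ρ (inj₁ a') v with back a' in eq
  ... | just a = leaf-label (flabel (ρ v)) eq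
  ... | nothing = mk⇔ (λ never → contradiction refl never)
                      (λ e → contradiction e (absent-label (flabel (ρ v)) eq))

  _≈_ : {s : Forest A B} → Assign s → Assign (mapF f s) → Set
  ρ ≈ ρ' = ∀ v → ρ' v ≡ posF (ρ v)

  update-≈ : {s : Forest A B} {ρ : Assign s} {ρ' : Assign (mapF f s)} → ρ ≈ ρ' →
    ∀ v p {p'} → p' ≡ posF p → update ρ v p ≈ update ρ' v p'
  update-≈ e vx p q vx = q
  update-≈ e vx p q vy = e vy
  update-≈ e vy p q vx = e vx
  update-≈ e vy p q vy = q

  sat-pull : ∀ {s : Forest A B} φ (ρ : Assign s) (ρ' : Assign (mapF f s)) → ρ ≈ ρ' →
    Sat s ρ (pull φ) ⇔ Sat (mapF f s) ρ' φ
  sat-pull (lab ℓ v) ρ ρ' e rewrite e v | label-posF (ρ v) = sat-pull-lab ρ ℓ v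
  sat-pull (v ≐ w) ρ ρ' e rewrite e v | e w = mk⇔ (cong posF) posF-injective
  sat-pull (v <v w) ρ ρ' e rewrite e v | e w = mk⇔ anc-posF (anc-reflectF (ρ v) (ρ w))
  sat-pull (v <h w) ρ ρ' e rewrite e v | e w = mk⇔ sib-posF (sib-reflectF (ρ v) (ρ w))
  sat-pull (¬' φ) ρ ρ' e =
    mk⇔ (λ n x → n (from (sat-pull φ ρ ρ' e) x)) (λ n x → n (to (sat-pull φ ρ ρ' e) x))
  sat-pull (φ ∧' ψ) ρ ρ' e =
    mk⇔ (λ (x , y) → to (sat-pull φ ρ ρ' e) x , to (sat-pull ψ ρ ρ' e) y)
        (λ (x , y) → from (sat-pull φ ρ ρ' e) x , from (sat-pull ψ ρ ρ' e) y)
  sat-pull {s} (∃' v φ) ρ ρ' e = mk⇔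
    (λ (p , x) → posF p , to (sat-pull φ _ _ (update-≈ e v p refl)) x)
    (λ (p' , x) → unposF s p' ,
       from (sat-pull φ _ _ (update-≈ e v (unposF s p') (sym (posF-unposF s p')))) x)

  models-pull : ∀ (s : Forest A B) φ → (s ⊨ pull φ) ⇔ (mapF f s ⊨ φ)
  models-pull s φ = sat-pull φ _ _ (λ _ → first-posF s)

  definable-pullback : {L : Forest A' B → Set} → Definable L → Definable (L ∘ mapF f)
  definable-pullback (φ , sent , defines) = pull φ , pull-sentence φ sent , λ s →
    (λ x → from (models-pull s φ) (proj₁ (defines (mapF f s)) x)) ,
    (λ y → proj₂ (defines (mapF f s)) (to (models-pull s φ) y))

definable-resp : {A B : Set} {L K : Forest A B → Set} →
  Definable L → (∀ s → L s ⇔ K s) → Definable K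
definable-resp (φ , sent , defines) L⇔K = φ , sent , λ s →
  (λ x → proj₁ (defines s) (from (L⇔K s) x)) ,
  (λ y → to (L⇔K s) (proj₂ (defines s) y))

oldLetter : {A H : Set} → A ⊎ H → Maybe A
oldLetter (inj₁ a) = just a
oldLetter (inj₂ h) = nothing

oldLetter-just : {A H : Set} {x : A ⊎ H} {a : A} → oldLetter x ≡ just a → inj₁ a ≡ x
oldLetter-just {x = inj₁ a} refl = refl

lemma4p1 : (A B : Set) → Finite A → Finite B →
    (F : ForestAlgebra) → Finite (ForestAlgebra.H F) → Finite (ForestAlgebra.V F) →
    (α : Morphism A B F) → (β : Morphism (A ⊎ ForestAlgebra.H F) B F) →
    IsLeafCompletion α β → (h : ForestAlgebra.H F) →
    Definable (λ s → Morphism.fH β s ≡ h) →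
    Definable (λ s → Morphism.fH α s ≡ h)
lemma4p1 A B _ _ F _ _ α β completion h β⁻¹h-definable =
  definable-resp (definable-pullback β⁻¹h-definable) β∘inj₁⁻¹h⇔α⁻¹h
  where
  open Pullback {A} {A ⊎ ForestAlgebra.H F} {B} inj₁ oldLetter (λ _ → refl) oldLetter-just
  open IsLeafCompletion completion using (ext-H)

  β∘inj₁⁻¹h⇔α⁻¹h : ∀ s → (Morphism.fH β (mapF inj₁ s) ≡ h) ⇔ (Morphism.fH α s ≡ h)
  β∘inj₁⁻¹h⇔α⁻¹h s = mk⇔ (trans (sym (ext-H s))) (trans (ext-H s))
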